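{- Let $\mathcal{C}\le\mathbb{F}_{q^m}^n$ be a non-degenerate $[n,k]_{q^m/q}$ rank-metric code and let $c\in\mathcal{C}^\perp$. Then $V=\sigma(c)\le\mathbb{F}_q^n$ is a cyclic space of the $q$-matroid $M_{\mathcal{C}}$.
   Context: $q$ is a prime power, $m,n,k$ positive integers. An $[n,k]_{q^m/q}$ rank-metric code is a $k$-dimensional $\mathbb{F}_{q^m}$-linear subspace $\mathcal{C}$ of $\mathbb{F}_{q^m}^n$; it is non-degenerate if the columns of a generator matrix ($k\times n$ matrix whose rows form a basis of $\mathcal{C}$) are linearly independent over $\mathbb{F}_q$. $\mathcal{C}^\perp$ is the dual code with respect to the standard dot product $x\cdot y=\sum_j x_jy_j$ on $\mathbb{F}_{q^m}^n$. For $v\in\mathbb{F}_{q^m}^n$ and an $\mathbb{F}_q$-basis $\gamma_1,\dots,\gamma_m$ of $\mathbb{F}_{q^m}$, write $v_i=\sum_j\Gamma(v)_{ij}\gamma_j$ with $\Gamma(v)\in\mathbb{F}_q^{n\times m}$; the support $\sigma(v)\le\mathbb{F}_q^n$ is the column space of $\Gamma(v)$ (independent of the basis). For $U\le\mathbb{F}_q^n$ let $U^\perp$ be its orthogonal complement in $\mathbb{F}_q^n$ under the standard dot product and $\mathcal{C}(U)=\{v\in\mathcal{C}:\sigma(v)\le U^\perp\}$. The $q$-matroid $M_{\mathcal{C}}=(\mathbb{F}_q^n,r)$ has rank function $r(U)=k-\dim_{\mathbb{F}_{q^m}}\mathcal{C}(U)$. A subspace $A$ is cyclic if $r(B)=r(A)$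 for every subspace $B\le A$ of codimension $1$ in $A$. -}

module Defs where

open import Level using (Level) renaming (suc to lsuc; zero to lzero)
open import Data.Nat using (ℕ; zero; suc; _∸_; _^_; _≤_)
open import Data.Nat.Primality using (Prime)
open import Data.Fin using (Fin) renaming (zero to fzero; suc to fsuc)
open import Data.Product using (Σ; ∃; ∃-syntax; _×_; _,_)
open import Relation.Binary.PropositionalEquality using (_≡_; _≢_)
open import Relation.Nullary using (¬_)
open import Function.Bundles using (_↔_)
open import Algebra.Structures using (IsCommutativeRing)

record Field : Set₁ where
  infixl 6 _+_
  infixl 7 _*_
  field
    Carrier : Set
    _+_ _*_ : Carrier → Carrier → Carrier
    -_      : Carrier → Carrier
    0# 1#   : Carrier
    isCommutativeRing : IsCommutativeRing _≡_ _+_ _*_ -_ 0# 1#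
    1≢0     : 1# ≢ 0#
    inverse : ∀ x → x ≢ 0# → ∃[ y ] (x * y ≡ 1#)

HasCardinality : Field → ℕ → Set
HasCardinality F q = Fin q ↔ Field.Carrier F

IsPrimePower : ℕ → Set
IsPrimePower q = ∃[ p ] ∃[ e ] (Prime p × 1 ≤ e × q ≡ p ^ e)

module LinAlg (F : Field) where
  open Field F

  sum : ∀ {n} → (Fin n → Carrier) → Carrier
  sum {zero}  f = 0#
  sum {suc n} f = f fzero + sum (λ i → f (fsuc i))

  Vector : ℕ → Set
  Vector n = Fin n → Carrier

  _·_ : ∀ {n} → Vector n → Vector n → Carrier
  x · y = sum (λ j → x j * y j)

  lincomb : ∀ {n d} → (Fin d → Carrier) → (Fin d → Vector n) → Vector n
  lincomb a b j = sum (λ i → a i * b i j)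

  Pred : ℕ → Set₁
  Pred n = Vector n → Set

  record IsSubspace {n} (P : Pred n) : Set where
    field
      respects : ∀ x y → (∀ j → x j ≡ y j) → P x → P y
      has-zero : P (λ _ → 0#)
      closed-+ : ∀ x y → P x → P y → P (λ j → x j + y j)
      closed-* : ∀ a x → P x → P (λ j → a * x j)

  _⊆_ : ∀ {n} → Pred n → Pred n → Set
  P ⊆ Q = ∀ x → P x → Q x

  LinearlyIndependent : ∀ {n d} → (Fin d → Vector n) → Set
  LinearlyIndependent b =
    ∀ a → (∀ j → lincomb a b j ≡ 0#) → ∀ i → a i ≡ 0#

  HasDim : ∀ {n} → Pred n → ℕ → Set
  HasDim {n} P d = ∃[ b ] ((∀ i → P (b i)) × LinearlyIndependent {n} {d} b
                    × (∀ x → P x → ∃[ a ] (∀ j → x j ≡ lincomb a b j)))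

  Span : ∀ {n d} → (Fin d → Vector n) → Pred n
  Span b x = ∃[ a ] (∀ j → x j ≡ lincomb a b j)

  _⊥ : ∀ {n} → Pred n → Pred n
  (U ⊥) x = ∀ u → U u → u · x ≡ 0#

record Extension (K L : Field) (m : ℕ) : Set where
  private
    module K = Field K
    module L = Field L
  field
    ι     : K.Carrier → L.Carrier
    ι-+   : ∀ a b → ι (a K.+ b) ≡ ι a L.+ ι b
    ι-*   : ∀ a b → ι (a K.* b) ≡ ι a L.* ι b
    ι-1   : ι K.1# ≡ L.1#
    γ     : Fin m → L.Carrier
    coord : L.Carrier → Fin m → K.Carrier
    expand : ∀ x → x ≡ LinAlg.sum L (λ j → ι (coord x j) L.* γ j)
    basis-indep : ∀ (a : Fin m → K.Carrier) →
      LinAlg.sum L (λ j → ι (a j) L.* γ j) ≡ L.0# → ∀ j → a j ≡ K.0#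

module RankMetric {K L : Field} {m : ℕ} (E : Extension K L m) where
  private
    module K = Field K
    module L = Field L
    module KL = LinAlg K
    module LL = LinAlg L
  open Extension E

  -- Γ(v) ∈ F_q^{n×m}:  v_i = Σ_j Γ(v)_{ij} γ_j
  Γ : ∀ {n} → LL.Vector n → Fin n → Fin m → K.Carrier
  Γ v i j = coord (v i) j

  σ : ∀ {n} → LL.Vector n → KL.Pred n
  σ v = KL.Span (λ j i → Γ v i j)

  module Code {n k : ℕ} (G : Fin k → Fin n → L.Carrier) where

    IsGeneratorMatrix : Set
    IsGeneratorMatrix = LL.LinearlyIndependent G

    C : LL.Pred n
    C = LL.Span G

    NonDegenerate : Set
    NonDegenerate = ∀ (a : Fin n → K.Carrier) →
      (∀ i → LL.sum (λ j → ι (a j) L.* G i j) ≡ L.0#) → ∀ j → a j ≡ K.0#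

    C⊥ : LL.Pred n
    C⊥ c = ∀ v → C v → v LL.· c ≡ L.0#

    C[_] : KL.Pred n → LL.Pred n
    C[ U ] v = C v × (σ v KL.⊆ (U KL.⊥))

    HasRank : KL.Pred n → ℕ → Set
    HasRank U r = ∃[ e ] (LL.HasDim (C[ U ]) e × r ≡ k ∸ e)

    Cyclic : KL.Pred n → Set₁
    Cyclic A = ∀ (B : KL.Pred n) → KL.IsSubspace B → B KL.⊆ A →
      ∀ d → KL.HasDim A (suc d) → KL.HasDim B d →
      ∀ rB rA → HasRank B rB → HasRank A rA → rB ≡ rA

{-# OPTIONS --safe #-}
module Submission where

-- For v ∈ C, σ(v) ⊆ U⊥ exactly when the K-linear map u ↦ ⟪ u , v ⟫ = ∑ᵢ uᵢ vᵢ ∈ L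
-- vanishes on U, so it suffices to show: if v · c = 0 and ⟪ −, v ⟫ vanishes on a
-- hyperplane B of σ(c), it vanishes on σ(c). Otherwise pick w ∈ σ(c) with
-- ⟪ w , v ⟫ ≠ 0; then σ(c) = B ⊕ K w, so the j-th column of Γ(c) pairs to μⱼ ⟪ w , v ⟫
-- with μⱼ ∈ K, and 0 = v · c = ∑ⱼ ⟪ Γ(c)ⱼ , v ⟫ γⱼ = ⟪ w , v ⟫ ∑ⱼ μⱼ γⱼ forces μ = 0,
-- hence ⟪ w , v ⟫ = 0. Thus C(B) = C(σ(c)) and the ranks agree.
-- Finiteness of K is only used for decidable equality.

open import Defs
open import Data.Nat using (ℕ; _≤_)
open import Data.Fin using (Fin)

open import Level using (0ℓ)
open import Algebra.Bundles using (CommutativeRing)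
import Algebra.Properties.CommutativeSemigroup as CommutativeSemigroupProperties
import Algebra.Properties.Ring as RingProperties
import Algebra.Properties.Semiring.Sum as SemiringSum
open import Data.Empty using (⊥-elim)
open import Data.Fin using (zero; suc; punchIn; punchOut)
open import Data.Fin.Properties using (any?; all?; punchIn-punchOut; inj⇒≟)
  renaming (_≟_ to _≟ᶠ_)
open import Data.Nat using (zero; suc; s≤s; _<_; _∸_)
open import Data.Nat.Properties using (≤-antisym; ≰⇒>; n<1+n; _≤?_)
open import Data.Product using (∃-syntax; _×_; _,_; proj₁; proj₂)
open import Data.Vec.Functional using (_∷_; tail; replicate)
open import Function.Properties.Inverse using (↔⇒↣; ↔-sym)
open import Relation.Binary.Definitions using (DecidableEquality)
open import Relation.Binary.PropositionalEquality
open import Relation.Nullary using (yes; no; ¬?)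
open import Relation.Nullary.Decidable using (map′; decidable-stable)

module FieldProperties (F : Field) where
  open Field F public
  open LinAlg F public

  commutativeRing : CommutativeRing 0ℓ 0ℓ
  commutativeRing = record { isCommutativeRing = isCommutativeRing }

  open CommutativeRing commutativeRing public
    using ( +-comm; *-assoc; *-comm; distribʳ; +-identityˡ; +-identityʳ
          ; -‿inverseʳ; zeroˡ; zeroʳ; *-identityˡ; *-identityʳ)
  open RingProperties (CommutativeRing.ring commutativeRing) public
    using (-‿distribˡ-*; -‿distribʳ-*; x+x≈x⇒x≈0; +-inverseˡ-unique)
  open CommutativeSemigroupProperties
         (CommutativeRing.*-commutativeSemigroup commutativeRing) public
    using (x∙yz≈y∙xz)
  private
    module ∑ = SemiringSum (CommutativeRing.semiring commutativeRing)
  open ≡-Reasoning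

  sum≡∑ : ∀ {n} (f : Vector n) → sum f ≡ ∑.sum f
  sum≡∑ {zero}  f = refl
  sum≡∑ {suc n} f = cong (f zero +_) (sum≡∑ (λ i → f (suc i)))

  sum-cong : ∀ {n} {f g : Vector n} → (∀ i → f i ≡ g i) → sum f ≡ sum g
  sum-cong {f = f} {g} f≗g = trans (sum≡∑ f) (trans (∑.sum-cong-≗ f≗g) (sym (sum≡∑ g)))

  sum-zero : ∀ {n} {f : Vector n} → (∀ i → f i ≡ 0#) → sum f ≡ 0#
  sum-zero {n} f≗0 =
    trans (sum-cong f≗0) (trans (sum≡∑ (replicate n 0#)) (∑.sum-replicate-zero n))

  sum-+ : ∀ {n} (f g : Vector n) → sum (λ i → f i + g i) ≡ sum f + sum g
  sum-+ f g = trans (sum≡∑ (λ i → f i + g i))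
    (trans (∑.∑-distrib-+ f g) (sym (cong₂ _+_ (sum≡∑ f) (sum≡∑ g))))

  *-distribˡ-sum : ∀ {n} x (f : Vector n) → x * sum f ≡ sum (λ i → x * f i)
  *-distribˡ-sum x f = trans (cong (x *_) (sum≡∑ f))
    (trans (∑.*-distribˡ-sum x f) (sym (sum≡∑ (λ i → x * f i))))

  sum-comm : ∀ {m n} (f : Fin m → Fin n → Carrier) →
    sum (λ i → sum (f i)) ≡ sum (λ j → sum (λ i → f i j))
  sum-comm f = begin
    sum (λ i → sum (f i))              ≡⟨ sum²≡∑² f ⟩
    ∑.sum (λ i → ∑.sum (f i))          ≡⟨ ∑.∑-comm f ⟩
    ∑.sum (λ j → ∑.sum (λ i → f i j))  ≡⟨ sum²≡∑² (λ j i → f i j) ⟨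
    sum (λ j → sum (λ i → f i j))      ∎
    where
    sum²≡∑² : ∀ {m n} (g : Fin m → Fin n → Carrier) →
      sum (λ i → sum (g i)) ≡ ∑.sum (λ i → ∑.sum (g i))
    sum²≡∑² g = trans (sum-cong (λ i → sum≡∑ (g i))) (sum≡∑ (λ i → ∑.sum (g i)))

  ·-comm : ∀ {n} (x y : Vector n) → x · y ≡ y · x
  ·-comm x y = sum-cong (λ i → *-comm (x i) (y i))

  ·-congʳ : ∀ {n} (x : Vector n) {y y′ : Vector n} → (∀ i → y i ≡ y′ i) → x · y ≡ x · y′
  ·-congʳ x y≗y′ = sum-cong (λ i → cong (x i *_) (y≗y′ i))

  ·-lincomb : ∀ {n d} (x : Vector n) (a : Fin d → Carrier) (b : Fin d → Vector n) →
    x · lincomb a b ≡ sum (λ j → a j * (x · b j))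
  ·-lincomb x a b = begin
    sum (λ i → x i * sum (λ j → a j * b j i))
      ≡⟨ sum-cong (λ i → *-distribˡ-sum (x i) (λ j → a j * b j i)) ⟩
    sum (λ i → sum (λ j → x i * (a j * b j i)))
      ≡⟨ sum-comm (λ i j → x i * (a j * b j i)) ⟩
    sum (λ j → sum (λ i → x i * (a j * b j i)))
      ≡⟨ sum-cong (λ j → sum-cong (λ i → x∙yz≈y∙xz (x i) (a j) (b j i))) ⟩
    sum (λ j → sum (λ i → a j * (x i * b j i)))
      ≡⟨ sum-cong (λ j → *-distribˡ-sum (a j) (λ i → x i * b j i)) ⟨
    sum (λ j → a j * (x · b j))
      ∎

  lincomb-· : ∀ {n d} (a : Fin d → Carrier) (b : Fin d → Vector n) (x : Vector n) →
    lincomb a b · x ≡ sum (λ j → a j * (b j · x))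
  lincomb-· a b x = trans (·-comm (lincomb a b) x)
    (trans (·-lincomb x a b) (sum-cong (λ j → cong (a j *_) (·-comm x (b j)))))

  ·-linearˡ : ∀ {n} (a b y : Vector n) c → (λ j → a j + c * b j) · y ≡ a · y + c * (b · y)
  ·-linearˡ a b y c = begin
    sum (λ j → (a j + c * b j) * y j)
      ≡⟨ sum-cong (λ j → trans (distribʳ (y j) (a j) (c * b j))
                               (cong (a j * y j +_) (*-assoc c (b j) (y j)))) ⟩
    sum (λ j → a j * y j + c * (b j * y j))
      ≡⟨ sum-+ (λ j → a j * y j) (λ j → c * (b j * y j)) ⟩
    a · y + sum (λ j → c * (b j * y j))
      ≡⟨ cong (a · y +_) (*-distribˡ-sum c (λ j → b j * y j)) ⟨
    a · y + c * (b · y)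
      ∎

  Span-generator : ∀ {n d} (b : Fin d → Vector n) (j : Fin d) → Span b (b j)
  Span-generator b j = δ j , λ i → sym (sum-δ j (λ j′ → b j′ i))
    where
    δ : ∀ {d} → Fin d → Fin d → Carrier
    δ zero    zero     = 1#
    δ zero    (suc _)  = 0#
    δ (suc _) zero     = 0#
    δ (suc j) (suc j′) = δ j j′

    sum-δ : ∀ {d} (j : Fin d) (f : Fin d → Carrier) → sum (λ j′ → δ j j′ * f j′) ≡ f j
    sum-δ zero    f = trans (cong₂ _+_ (*-identityˡ (f zero)) (sum-zero (λ i → zeroˡ (f (suc i)))))
                            (+-identityʳ (f zero))
    sum-δ (suc j) f = trans (cong₂ _+_ (zeroˡ (f zero)) (sum-δ j (λ i → f (suc i))))
                            (+-identityˡ (f (suc j)))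

  cancel-nonzeroʳ : ∀ {x y} → y ≢ 0# → x * y ≡ 0# → x ≡ 0#
  cancel-nonzeroʳ {x} {y} y≢0 xy≡0 with inverse y y≢0
  ... | y⁻¹ , yy⁻¹≡1 = begin
    x              ≡⟨ *-identityʳ x ⟨
    x * 1#         ≡⟨ cong (x *_) yy⁻¹≡1 ⟨
    x * (y * y⁻¹)  ≡⟨ *-assoc x y y⁻¹ ⟨
    (x * y) * y⁻¹  ≡⟨ cong (_* y⁻¹) xy≡0 ⟩
    0# * y⁻¹       ≡⟨ zeroˡ y⁻¹ ⟩
    0#             ∎

  cancel-nonzeroˡ : ∀ {x y} → x ≢ 0# → x * y ≡ 0# → y ≡ 0#
  cancel-nonzeroˡ {x} {y} x≢0 xy≡0 = cancel-nonzeroʳ x≢0 (trans (*-comm y x) xy≡0)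

module LinearAlgebra (F : Field) (_≟_ : DecidableEquality (Field.Carrier F)) where
  open FieldProperties F
  open ≡-Reasoning

  Nontrivial : ∀ {d} → Vector d → Set
  Nontrivial x = ∃[ i ] (x i ≢ 0#)

  NontrivialSolution : ∀ {e d} → (Fin e → Vector d) → Set
  NontrivialSolution M = ∃[ x ] (Nontrivial x × ∀ k → M k · x ≡ 0#)

  LinearlyDependent : ∀ {n d} → (Fin d → Vector n) → Set
  LinearlyDependent z = ∃[ x ] (Nontrivial x × ∀ j → lincomb x z j ≡ 0#)

  -- Gaussian elimination on the first column, pivoting on row p.
  module Elimination {e d} (M : Fin (suc e) → Vector (suc d)) (p : Fin (suc e))
                     {p⁻¹ : Carrier} (pp⁻¹≡1 : M p zero * p⁻¹ ≡ 1#) where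

    reduce : Vector (suc d) → Vector d
    reduce r j = r (suc j) + (- (r zero * p⁻¹)) * M p (suc j)

    reduced : Fin e → Vector d
    reduced k = reduce (M (punchIn p k))

    extend : Vector d → Vector (suc d)
    extend y = (- (p⁻¹ * (tail (M p) · y))) ∷ y

    ·-extend : ∀ r y → r · extend y ≡ reduce r · y
    ·-extend r y = begin
      r zero * (- (p⁻¹ * S)) + tail r · y  ≡⟨ cong (_+ tail r · y) (-‿distribʳ-* (r zero) (p⁻¹ * S)) ⟨
      - (r zero * (p⁻¹ * S)) + tail r · y  ≡⟨ cong (λ t → - t + tail r · y) (*-assoc (r zero) p⁻¹ S) ⟨
      - ((r zero * p⁻¹) * S) + tail r · y  ≡⟨ cong (_+ tail r · y) (-‿distribˡ-* (r zero * p⁻¹) S) ⟩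
      (- (r zero * p⁻¹)) * S + tail r · y  ≡⟨ +-comm _ (tail r · y) ⟩
      tail r · y + (- (r zero * p⁻¹)) * S  ≡⟨ ·-linearˡ (tail r) (tail (M p)) y _ ⟨
      reduce r · y                         ∎
      where
      S : Carrier
      S = tail (M p) · y

    reduce-pivot : ∀ y → reduce (M p) · y ≡ 0#
    reduce-pivot y = begin
      reduce (M p) · y                 ≡⟨ ·-linearˡ (tail (M p)) (tail (M p)) y _ ⟩
      S + (- (M p zero * p⁻¹)) * S     ≡⟨ cong (λ t → S + (- t) * S) pp⁻¹≡1 ⟩
      S + (- 1#) * S                   ≡⟨ cong (S +_) (-‿distribˡ-* 1# S) ⟨
      S + - (1# * S)                   ≡⟨ cong (λ t → S + - t) (*-identityˡ S) ⟩
      S + - S                          ≡⟨ -‿inverseʳ S ⟩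
      0#                               ∎
      where
      S : Carrier
      S = tail (M p) · y

    extend-solves : ∀ y → (∀ k → reduced k · y ≡ 0#) → ∀ k → M k · extend y ≡ 0#
    extend-solves y y-solves k = trans (·-extend (M k) y) (reduce-solves k)
      where
      reduce-solves : ∀ k → reduce (M k) · y ≡ 0#
      reduce-solves k with p ≟ᶠ k
      ... | yes refl = reduce-pivot y
      ... | no p≢k   =
        subst (λ k → reduce (M k) · y ≡ 0#) (punchIn-punchOut p≢k) (y-solves (punchOut p≢k))

  first-column-zero-solution : ∀ {e d} (M : Fin e → Vector (suc d)) →
    (∀ k → M k zero ≡ 0#) → NontrivialSolution M
  first-column-zero-solution M col≡0 = (1# ∷ λ _ → 0#) , (zero , 1≢0) , solves
    where
    solves : ∀ k → M k · (1# ∷ λ _ → 0#) ≡ 0#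
    solves k = trans (cong₂ _+_ (trans (*-identityʳ (M k zero)) (col≡0 k))
                                (sum-zero (λ i → zeroʳ (M k (suc i)))))
                     (+-identityˡ 0#)

  nontrivialSolution : ∀ {e d} → e < d → (M : Fin e → Vector d) → NontrivialSolution M
  nontrivialSolution {zero}  {suc d} _          M = (λ _ → 1#) , (zero , 1≢0) , λ ()
  nontrivialSolution {suc e} {suc d} (s≤s e<d) M with any? (λ k → ¬? (M k zero ≟ 0#))
  ... | no no-pivot = first-column-zero-solution M
        (λ k → decidable-stable (M k zero ≟ 0#) (λ Mk≢0 → no-pivot (k , Mk≢0)))
  ... | yes (p , pivot≢0) with inverse (M p zero) pivot≢0
  ... | p⁻¹ , pp⁻¹≡1 = pivot-solution
    where
    open Elimination M p pp⁻¹≡1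
    pivot-solution : NontrivialSolution M
    pivot-solution with nontrivialSolution e<d reduced
    ... | y , (i , yi≢0) , y-solves = extend y , (suc i , yi≢0) , extend-solves y y-solves

  span-dependent : ∀ {n D E} → E < D → (a : Fin E → Vector n) (z : Fin D → Vector n) →
    (∀ i → Span a (z i)) → LinearlyDependent z
  span-dependent {n} {D} {E} E<D a z z∈span
    with nontrivialSolution E<D (λ k i → proj₁ (z∈span i) k)
  ... | x , nontrivial , x-solves = x , nontrivial , lincomb≡0
    where
    c : Fin D → Fin E → Carrier
    c i = proj₁ (z∈span i)

    x·c≡0 : ∀ k → x · (λ i → c i k) ≡ 0#
    x·c≡0 k = trans (·-comm x (λ i → c i k)) (x-solves k)

    lincomb≡0 : ∀ j → lincomb x z j ≡ 0#
    lincomb≡0 j = begin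
      sum (λ i → x i * z i j)
        ≡⟨ sum-cong (λ i → cong (x i *_) (proj₂ (z∈span i) j)) ⟩
      sum (λ i → x i * lincomb (c i) a j)
        ≡⟨ ·-congʳ x (λ i → sum-cong (λ k → *-comm (c i k) (a k j))) ⟩
      x · lincomb (λ k → a k j) (λ k i → c i k)
        ≡⟨ ·-lincomb x (λ k → a k j) (λ k i → c i k) ⟩
      sum (λ k → a k j * (x · (λ i → c i k)))
        ≡⟨ sum-zero (λ k → trans (cong (a k j *_) (x·c≡0 k)) (zeroʳ (a k j))) ⟩
      0#
        ∎

  independent⇒≤ : ∀ {n d e} (b : Fin d → Vector n) (a : Fin e → Vector n) →
    LinearlyIndependent b → (∀ i → Span a (b i)) → d ≤ e
  independent⇒≤ {d = d} {e} b a b-ind b∈span with d ≤? e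
  ... | yes d≤e = d≤e
  ... | no d≰e with span-dependent (≰⇒> d≰e) a b b∈span
  ... | x , (i , xi≢0) , lincomb≡0 = ⊥-elim (xi≢0 (b-ind x lincomb≡0 i))

  HasDim-mono : ∀ {n} {P Q : Pred n} {d e} → HasDim P d → HasDim Q e → P ⊆ Q → d ≤ e
  HasDim-mono (b , b∈P , b-ind , _) (_ , _ , _ , Q-spanned) P⊆Q =
    independent⇒≤ b _ b-ind (λ i → Q-spanned (b i) (P⊆Q _ (b∈P i)))

  HasDim-cong : ∀ {n} {P Q : Pred n} {d e} → HasDim P d → HasDim Q e → P ⊆ Q → Q ⊆ P → d ≡ e
  HasDim-cong dimP dimQ P⊆Q Q⊆P =
    ≤-antisym (HasDim-mono dimP dimQ P⊆Q) (HasDim-mono dimQ dimP Q⊆P)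

  independent-∷-head≡0 : ∀ {n d} {z : Vector n} {b : Fin d → Vector n} →
    LinearlyIndependent b →
    ∀ x → x zero ≡ 0# → (∀ j → lincomb x (z ∷ b) j ≡ 0#) → ∀ i → x i ≡ 0#
  independent-∷-head≡0         b-ind x x₀≡0 lincomb≡0 zero    = x₀≡0
  independent-∷-head≡0 {z = z} {b} b-ind x x₀≡0 lincomb≡0 (suc i) = b-ind (tail x) tail≡0 i
    where
    tail≡0 : ∀ j → lincomb (tail x) b j ≡ 0#
    tail≡0 j = begin
      T                  ≡⟨ +-identityˡ T ⟨
      0# + T             ≡⟨ cong (_+ T) (zeroˡ (z j)) ⟨
      0# * z j + T       ≡⟨ cong (λ t → t * z j + T) x₀≡0 ⟨
      x zero * z j + T   ≡⟨ lincomb≡0 j ⟩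
      0#                 ∎
      where
      T : Carrier
      T = lincomb (tail x) b j

  dependent-∷⇒Span : ∀ {n d} {z : Vector n} {b : Fin d → Vector n} →
    LinearlyIndependent b → LinearlyDependent (z ∷ b) → Span b z
  dependent-∷⇒Span {z = z} {b} b-ind (x , (i , xi≢0) , lincomb≡0) with x zero ≟ 0#
  ... | yes x₀≡0 = ⊥-elim (xi≢0 (independent-∷-head≡0 b-ind x x₀≡0 lincomb≡0 i))
  ... | no x₀≢0 with inverse (x zero) x₀≢0
  ... | x₀⁻¹ , x₀x₀⁻¹≡1 = (λ i → (- x₀⁻¹) * tail x i) , z≡lincomb
    where
    z≡lincomb : ∀ j → z j ≡ lincomb (λ i → (- x₀⁻¹) * tail x i) b j
    z≡lincomb j = begin
      z j                              ≡⟨ *-identityˡ (z j) ⟨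
      1# * z j                         ≡⟨ cong (_* z j) (trans (*-comm x₀⁻¹ (x zero)) x₀x₀⁻¹≡1) ⟨
      (x₀⁻¹ * x zero) * z j            ≡⟨ *-assoc x₀⁻¹ (x zero) (z j) ⟩
      x₀⁻¹ * (x zero * z j)            ≡⟨ cong (x₀⁻¹ *_) (+-inverseˡ-unique _ _ (lincomb≡0 j)) ⟩
      x₀⁻¹ * (- T)                     ≡⟨ -‿distribʳ-* x₀⁻¹ T ⟨
      - (x₀⁻¹ * T)                     ≡⟨ -‿distribˡ-* x₀⁻¹ T ⟩
      (- x₀⁻¹) * T                     ≡⟨ *-distribˡ-sum (- x₀⁻¹) (λ i → tail x i * b i j) ⟩
      sum (λ i → (- x₀⁻¹) * (tail x i * b i j))
                                       ≡⟨ sum-cong (λ i → *-assoc (- x₀⁻¹) (tail x i) (b i j)) ⟨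
      lincomb (λ i → (- x₀⁻¹) * tail x i) b j ∎
      where
      T : Carrier
      T = lincomb (tail x) b j

  independent⇒Span : ∀ {n D} {V : Pred n} (b : Fin D → Vector n) → HasDim V D →
    (∀ i → V (b i)) → LinearlyIndependent b → ∀ z → V z → Span b z
  independent⇒Span b (a , _ , _ , V-spanned) b∈V b-ind z z∈V =
    dependent-∷⇒Span b-ind (span-dependent (n<1+n _) a (z ∷ b) z∷b∈span)
    where
    z∷b∈span : ∀ i → Span a ((z ∷ b) i)
    z∷b∈span zero    = V-spanned z z∈V
    z∷b∈span (suc i) = V-spanned (b i) (b∈V i)

finite⇒decidableEquality : ∀ (F : Field) q → HasCardinality F q →
  DecidableEquality (Field.Carrier F)
finite⇒decidableEquality F q card = inj⇒≟ (↔⇒↣ (↔-sym card))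

module ExtensionProperties {K L : Field} {m : ℕ} (E : Extension K L m)
                           (_≟K_ : DecidableEquality (Field.Carrier K)) where
  module K = FieldProperties K
  module L = FieldProperties L
  module KLinAlg = LinearAlgebra K _≟K_
  open Extension E
  open RankMetric E
  open ≡-Reasoning

  ι-0 : ι K.0# ≡ L.0#
  ι-0 = L.x+x≈x⇒x≈0 (ι K.0#) (trans (sym (ι-+ K.0# K.0#)) (cong ι (K.+-identityˡ K.0#)))

  ι0*≡0 : ∀ x → ι K.0# L.* x ≡ L.0#
  ι0*≡0 x = trans (cong (L._* x) ι-0) (L.zeroˡ x)

  ι-sum : ∀ {n} (f : K.Vector n) → ι (K.sum f) ≡ L.sum (λ i → ι (f i))
  ι-sum {zero}  f = ι-0
  ι-sum {suc n} f = trans (ι-+ _ _) (cong (ι (f zero) L.+_) (ι-sum (λ i → f (suc i))))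

  ι-· : ∀ {n} (x y : K.Vector n) → ι (x K.· y) ≡ (λ i → ι (x i)) L.· (λ i → ι (y i))
  ι-· x y = trans (ι-sum (λ i → x i K.* y i)) (L.sum-cong (λ i → ι-* (x i) (y i)))

  ι≡0⇒≡0 : ∀ a → ι a ≡ L.0# → a ≡ K.0#
  ι≡0⇒≡0 a ιa≡0 with a ≟K K.0#
  ... | yes a≡0 = a≡0
  ... | no a≢0 with K.inverse a a≢0
  ... | a⁻¹ , aa⁻¹≡1 = ⊥-elim (L.1≢0 (begin
    L.1#            ≡⟨ ι-1 ⟨
    ι K.1#          ≡⟨ cong ι aa⁻¹≡1 ⟨
    ι (a K.* a⁻¹)   ≡⟨ ι-* a a⁻¹ ⟩
    ι a L.* ι a⁻¹   ≡⟨ cong (L._* ι a⁻¹) ιa≡0 ⟩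
    L.0# L.* ι a⁻¹  ≡⟨ L.zeroˡ (ι a⁻¹) ⟩
    L.0#            ∎))

  _≟L_ : DecidableEquality (Field.Carrier L)
  x ≟L y = map′ coord≗⇒≡ (λ x≡y j → cong (λ t → coord t j) x≡y)
                (all? (λ j → coord x j ≟K coord y j))
    where
    coord≗⇒≡ : (∀ j → coord x j ≡ coord y j) → x ≡ y
    coord≗⇒≡ coord≗ = trans (expand x)
      (trans (L.sum-cong (λ j → cong (λ t → ι t L.* γ j) (coord≗ j))) (sym (expand y)))

  col : ∀ {n} → L.Vector n → Fin m → K.Vector n
  col v j i = Γ v i j

  col∈σ : ∀ {n} (v : L.Vector n) j → σ v (col v j)
  col∈σ v = K.Span-generator (col v)

  expand-columns : ∀ {n} (v : L.Vector n) i → v i ≡ L.lincomb γ (λ j i → ι (col v j i)) i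
  expand-columns v i = trans (expand (v i)) (L.sum-cong (λ j → L.*-comm (ι (col v j i)) (γ j)))

  ⟪_,_⟫ : ∀ {n} → K.Vector n → L.Vector n → L.Carrier
  ⟪ u , v ⟫ = (λ i → ι (u i)) L.· v

  ⟪,⟫-congˡ : ∀ {n} {u u′ : K.Vector n} (v : L.Vector n) →
    (∀ i → u i ≡ u′ i) → ⟪ u , v ⟫ ≡ ⟪ u′ , v ⟫
  ⟪,⟫-congˡ v u≗u′ = L.sum-cong (λ i → cong (λ t → ι t L.* v i) (u≗u′ i))

  ⟪0,⟫≡0 : ∀ {n} (v : L.Vector n) → ⟪ (λ _ → K.0#) , v ⟫ ≡ L.0#
  ⟪0,⟫≡0 v = L.sum-zero (λ i → ι0*≡0 (v i))

  ⟪lincomb,⟫ : ∀ {n d} (x : Fin d → K.Carrier) (z : Fin d → K.Vector n) (v : L.Vector n) →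
    ⟪ K.lincomb x z , v ⟫ ≡ L.sum (λ k → ι (x k) L.* ⟪ z k , v ⟫)
  ⟪lincomb,⟫ x z v = trans (L.sum-cong (λ i → cong (L._* v i) ι-lincomb))
                           (L.lincomb-· (λ k → ι (x k)) (λ k i → ι (z k i)) v)
    where
    ι-lincomb : ∀ {i} → ι (K.lincomb x z i) ≡ L.lincomb (λ k → ι (x k)) (λ k i → ι (z k i)) i
    ι-lincomb {i} =
      trans (ι-sum (λ k → x k K.* z k i)) (L.sum-cong (λ k → ι-* (x k) (z k i)))

  ⟪,⟫-coordinates : ∀ {n} (u : K.Vector n) (v : L.Vector n) →
    ⟪ u , v ⟫ ≡ L.sum (λ j → ι (u K.· col v j) L.* γ j)
  ⟪,⟫-coordinates u v = begin
    ιu L.· v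
      ≡⟨ L.·-congʳ ιu (expand-columns v) ⟩
    ιu L.· L.lincomb γ (λ j i → ι (col v j i))
      ≡⟨ L.·-lincomb ιu γ (λ j i → ι (col v j i)) ⟩
    L.sum (λ j → γ j L.* (ιu L.· (λ i → ι (col v j i))))
      ≡⟨ L.sum-cong (λ j → cong (γ j L.*_) (ι-· u (col v j))) ⟨
    L.sum (λ j → γ j L.* ι (u K.· col v j))
      ≡⟨ L.sum-cong (λ j → L.*-comm (γ j) (ι (u K.· col v j))) ⟩
    L.sum (λ j → ι (u K.· col v j) L.* γ j)
      ∎
    where
    ιu : L.Vector _
    ιu i = ι (u i)

  ∑⟪col,⟫γ≡· : ∀ {n} (c v : L.Vector n) → L.sum (λ j → ⟪ col c j , v ⟫ L.* γ j) ≡ v L.· c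
  ∑⟪col,⟫γ≡· c v = begin
    L.sum (λ j → ⟪ col c j , v ⟫ L.* γ j)
      ≡⟨ L.sum-cong (λ j → trans (L.*-comm ⟪ col c j , v ⟫ (γ j))
                                 (cong (γ j L.*_) (L.·-comm (ιcol j) v))) ⟩
    L.sum (λ j → γ j L.* (v L.· ιcol j))
      ≡⟨ L.·-lincomb v γ ιcol ⟨
    v L.· L.lincomb γ ιcol
      ≡⟨ L.·-congʳ v (expand-columns c) ⟨
    v L.· c
      ∎
    where
    ιcol : Fin m → L.Vector _
    ιcol j i = ι (col c j i)

  σ⊆⊥⇒⟪,⟫≡0 : ∀ {n} {U : K.Pred n} (v : L.Vector n) →
    σ v K.⊆ (U K.⊥) → ∀ u → U u → ⟪ u , v ⟫ ≡ L.0#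
  σ⊆⊥⇒⟪,⟫≡0 v σv⊆U⊥ u u∈U = trans (⟪,⟫-coordinates u v) (L.sum-zero (λ j →
    trans (cong (λ t → ι t L.* γ j) (σv⊆U⊥ (col v j) (col∈σ v j) u u∈U)) (ι0*≡0 (γ j))))

  ⟪,⟫≡0⇒σ⊆⊥ : ∀ {n} {U : K.Pred n} (v : L.Vector n) →
    (∀ u → U u → ⟪ u , v ⟫ ≡ L.0#) → σ v K.⊆ (U K.⊥)
  ⟪,⟫≡0⇒σ⊆⊥ v U⊥v x (a , x≡lincomb) u u∈U = begin
    u K.· x                                ≡⟨ K.·-congʳ u x≡lincomb ⟩
    u K.· K.lincomb a (col v)              ≡⟨ K.·-lincomb u a (col v) ⟩
    K.sum (λ j → a j K.* (u K.· col v j))  ≡⟨ K.sum-zero (λ j → trans (cong (a j K.*_) (u⊥col j))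
                                                                     (K.zeroʳ (a j))) ⟩
    K.0#                                   ∎
    where
    u⊥col : ∀ j → u K.· col v j ≡ K.0#
    u⊥col = basis-indep (λ j → u K.· col v j) (trans (sym (⟪,⟫-coordinates u v)) (U⊥v u u∈U))

  ⟪Span,⟫≡0 : ∀ {n d} (b : Fin d → K.Vector n) (v : L.Vector n) →
    (∀ i → ⟪ b i , v ⟫ ≡ L.0#) → ∀ u → K.Span b u → ⟪ u , v ⟫ ≡ L.0#
  ⟪Span,⟫≡0 b v b⊥v u (a , u≡lincomb) = begin
    ⟪ u , v ⟫                                ≡⟨ ⟪,⟫-congˡ v u≡lincomb ⟩
    ⟪ K.lincomb a b , v ⟫                    ≡⟨ ⟪lincomb,⟫ a b v ⟩
    L.sum (λ j → ι (a j) L.* ⟪ b j , v ⟫)    ≡⟨ L.sum-zero (λ j → trans (cong (ι (a j) L.*_) (b⊥v j))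
                                                                       (L.zeroʳ (ι (a j)))) ⟩
    L.0#                                     ∎

  ⟪lincomb-∷,⟫ : ∀ {n d} (w : K.Vector n) (b : Fin d → K.Vector n) (v : L.Vector n) →
    (∀ i → ⟪ b i , v ⟫ ≡ L.0#) → ∀ x → ⟪ K.lincomb x (w ∷ b) , v ⟫ ≡ ι (x zero) L.* ⟪ w , v ⟫
  ⟪lincomb-∷,⟫ w b v b⊥v x = begin
    ⟪ K.lincomb x (w ∷ b) , v ⟫                      ≡⟨ ⟪lincomb,⟫ x (w ∷ b) v ⟩
    ι (x zero) L.* ⟪ w , v ⟫ L.+ ∑b                  ≡⟨ cong (ι (x zero) L.* ⟪ w , v ⟫ L.+_) ∑b≡0 ⟩
    ι (x zero) L.* ⟪ w , v ⟫ L.+ L.0#                ≡⟨ L.+-identityʳ (ι (x zero) L.* ⟪ w , v ⟫) ⟩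
    ι (x zero) L.* ⟪ w , v ⟫                         ∎
    where
    ∑b : L.Carrier
    ∑b = L.sum (λ i → ι (x (suc i)) L.* ⟪ b i , v ⟫)
    ∑b≡0 : ∑b ≡ L.0#
    ∑b≡0 = L.sum-zero (λ i → trans (cong (ι (x (suc i)) L.*_) (b⊥v i)) (L.zeroʳ (ι (x (suc i)))))

  ∷-independent : ∀ {n d} (w : K.Vector n) (b : Fin d → K.Vector n) (v : L.Vector n) →
    K.LinearlyIndependent b → (∀ i → ⟪ b i , v ⟫ ≡ L.0#) → ⟪ w , v ⟫ ≢ L.0# →
    K.LinearlyIndependent (w ∷ b)
  ∷-independent w b v b-ind b⊥v w⊥̸v x lincomb≡0 =
    KLinAlg.independent-∷-head≡0 b-ind x x₀≡0 lincomb≡0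
    where
    x₀≡0 : x zero ≡ K.0#
    x₀≡0 = ι≡0⇒≡0 (x zero) (L.cancel-nonzeroʳ w⊥̸v (begin
      ι (x zero) L.* ⟪ w , v ⟫           ≡⟨ ⟪lincomb-∷,⟫ w b v b⊥v x ⟨
      ⟪ K.lincomb x (w ∷ b) , v ⟫        ≡⟨ ⟪,⟫-congˡ v lincomb≡0 ⟩
      ⟪ (λ _ → K.0#) , v ⟫               ≡⟨ ⟪0,⟫≡0 v ⟩
      L.0#                               ∎))

  columns-pairing-vanish : ∀ {n} (c v : L.Vector n) → v L.· c ≡ L.0# →
    ∀ {κ} (μ : Fin m → K.Carrier) → κ ≢ L.0# → (∀ j → ⟪ col c j , v ⟫ ≡ ι (μ j) L.* κ) →
    ∀ j → ⟪ col c j , v ⟫ ≡ L.0#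
  columns-pairing-vanish c v v·c≡0 {κ} μ κ≢0 col≡μκ j =
    trans (col≡μκ j) (trans (cong (λ t → ι t L.* κ) (μ≡0 j)) (ι0*≡0 κ))
    where
    κ∑μγ≡0 : κ L.* L.sum (λ j → ι (μ j) L.* γ j) ≡ L.0#
    κ∑μγ≡0 = begin
      κ L.* L.sum (λ j → ι (μ j) L.* γ j)
        ≡⟨ L.*-distribˡ-sum κ (λ j → ι (μ j) L.* γ j) ⟩
      L.sum (λ j → κ L.* (ι (μ j) L.* γ j))
        ≡⟨ L.sum-cong (λ j → trans (L.x∙yz≈y∙xz κ (ι (μ j)) (γ j))
                                   (sym (L.*-assoc (ι (μ j)) κ (γ j)))) ⟩
      L.sum (λ j → (ι (μ j) L.* κ) L.* γ j)
        ≡⟨ L.sum-cong (λ j → cong (L._* γ j) (col≡μκ j)) ⟨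
      L.sum (λ j → ⟪ col c j , v ⟫ L.* γ j)
        ≡⟨ ∑⟪col,⟫γ≡· c v ⟩
      v L.· c
        ≡⟨ v·c≡0 ⟩
      L.0#
        ∎
    μ≡0 : ∀ j → μ j ≡ K.0#
    μ≡0 = basis-indep μ (L.cancel-nonzeroˡ κ≢0 κ∑μγ≡0)

  ⟪,⟫≡0-extends-from-hyperplane : ∀ {n d} (c v : L.Vector n) → v L.· c ≡ L.0# →
    (B : K.Pred n) → B K.⊆ σ c → K.HasDim (σ c) (suc d) → K.HasDim B d →
    (∀ u → B u → ⟪ u , v ⟫ ≡ L.0#) → ∀ w → σ c w → ⟪ w , v ⟫ ≡ L.0#
  ⟪,⟫≡0-extends-from-hyperplane c v v·c≡0 B B⊆σc dimσc (b , b∈B , b-ind , _) B⊥v w w∈σc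
    with ⟪ w , v ⟫ ≟L L.0#
  ... | yes w⊥v = w⊥v
  ... | no w⊥̸v = ⟪Span,⟫≡0 (col c) v columns⊥v w w∈σc
    where
    b⊥v : ∀ i → ⟪ b i , v ⟫ ≡ L.0#
    b⊥v i = B⊥v (b i) (b∈B i)

    w∷b∈σc : ∀ i → σ c ((w ∷ b) i)
    w∷b∈σc zero    = w∈σc
    w∷b∈σc (suc i) = B⊆σc (b i) (b∈B i)

    col∈span : ∀ j → K.Span (w ∷ b) (col c j)
    col∈span j = KLinAlg.independent⇒Span (w ∷ b) dimσc w∷b∈σc
      (∷-independent w b v b-ind b⊥v w⊥̸v) (col c j) (col∈σ c j)

    μ : Fin m → K.Carrier
    μ j = proj₁ (col∈span j) zero

    col≡μw : ∀ j → ⟪ col c j , v ⟫ ≡ ι (μ j) L.* ⟪ w , v ⟫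
    col≡μw j = trans (⟪,⟫-congˡ v (proj₂ (col∈span j)))
                     (⟪lincomb-∷,⟫ w b v b⊥v (proj₁ (col∈span j)))

    columns⊥v : ∀ j → ⟪ col c j , v ⟫ ≡ L.0#
    columns⊥v = columns-pairing-vanish c v v·c≡0 μ w⊥̸v col≡μw

  module _ {n k : ℕ} (G : Fin k → Fin n → Field.Carrier L) where
    open Code G

    C[]-antitone : ∀ {U W : K.Pred n} → U K.⊆ W → C[ W ] L.⊆ C[ U ]
    C[]-antitone U⊆W v (v∈C , σv⊆W⊥) = v∈C , λ x x∈σv u u∈U → σv⊆W⊥ x x∈σv u (U⊆W u u∈U)

    C[hyperplane]⊆C[support] : ∀ {c d} (B : K.Pred n) → C⊥ c → B K.⊆ σ c →
      K.HasDim (σ c) (suc d) → K.HasDim B d → C[ B ] L.⊆ C[ σ c ]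
    C[hyperplane]⊆C[support] {c} B c∈C⊥ B⊆σc dimσc dimB v (v∈C , σv⊆B⊥) = v∈C ,
      ⟪,⟫≡0⇒σ⊆⊥ v (⟪,⟫≡0-extends-from-hyperplane c v (c∈C⊥ v v∈C) B B⊆σc dimσc dimB
                                                  (σ⊆⊥⇒⟪,⟫≡0 v σv⊆B⊥))

theorem4p12 : (q : ℕ) → IsPrimePower q →
    (K : Field) → HasCardinality K q →
    (m n k : ℕ) → 1 ≤ m → 1 ≤ n → 1 ≤ k →
    (L : Field) → (E : Extension K L m) →
    (G : Fin k → Fin n → Field.Carrier L) →
    RankMetric.Code.IsGeneratorMatrix E G →
    RankMetric.Code.NonDegenerate E G →
    (c : Fin n → Field.Carrier L) → RankMetric.Code.C⊥ E G c →
    RankMetric.Code.Cyclic E G (RankMetric.σ E c)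
theorem4p12 q _ K card m n k _ _ _ L E G _ _ c c∈C⊥ B _ B⊆σc d dimσc dimB rB rA
            (eB , dimC[B] , rB≡k∸eB) (eA , dimC[σc] , rA≡k∸eA) = begin
  rB      ≡⟨ rB≡k∸eB ⟩
  k ∸ eB  ≡⟨ cong (k ∸_) eB≡eA ⟩
  k ∸ eA  ≡⟨ rA≡k∸eA ⟨
  rA      ∎
  where
  open ≡-Reasoning
  open ExtensionProperties E (finite⇒decidableEquality K q card)
  eB≡eA : eB ≡ eA
  eB≡eA = LinearAlgebra.HasDim-cong L _≟L_ dimC[B] dimC[σc]
    (C[hyperplane]⊆C[support] G B c∈C⊥ B⊆σc dimσc dimB) (C[]-antitone G B⊆σc)
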